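{- A non-trivial connected graph $G$ has $\gamma_I^p(G)=2$ if and only if $G$ can be written as the join of two graphs $G_1$ and $G_2$, where $G_1$ is one of $K_1$, $2K_1$ (two isolated vertices), or $K_2$.
   Context: All graphs are finite, simple and undirected; non-trivial means having at least two vertices. The join of graphs $G_1$ and $G_2$ (on disjoint vertex sets) is their disjoint union together with all edges between $V(G_1)$ and $V(G_2)$. For a graph $G=(V,E)$ and $v\in V$, $N(v)$ denotes the set of neighbours of $v$. A perfect Italian dominating function (PID-function) of $G$ is a function $f:V\to\{0,1,2\}$ such that for every vertex $v$ with $f(v)=0$ one has $\sum_{u\in N(v)} f(u)=2$. The weight of $f$ is $\sum_{v\in V} f(v)$. The perfect Italian domination number $\gamma_I^p(G)$ is the minimum weight of a PID-function of $G$. -}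

module Defs where

open import Data.Nat using (ℕ; _≤_; _+_)
open import Data.Fin using (Fin; toℕ)
open import Data.List using (List; map; allFin)
open import Data.Nat.ListAction using (sum)
open import Data.Bool using (Bool; true; false; if_then_else_)
open import Data.Product using (Σ; ∃; ∃-syntax; _×_; _,_)
open import Data.Sum using (_⊎_)
open import Relation.Binary.PropositionalEquality using (_≡_; _≢_)
open import Relation.Nullary using (¬_)

record Graph (n : ℕ) : Set where
  field
    adj   : Fin n → Fin n → Bool
    sym   : ∀ u v → adj u v ≡ adj v u
    irrefl : ∀ v → adj v v ≡ false
open Graph public

data Walk {n : ℕ} (G : Graph n) : Fin n → Fin n → Set where
  here : ∀ {u} → Walk G u u
  step : ∀ {u w v} → adj G u w ≡ true → Walk G w v → Walk G u v

Connected : ∀ {n} → Graph n → Set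
Connected {n} G = ∀ (u v : Fin n) → Walk G u v

NonTrivial : ∀ {n} → Graph n → Set
NonTrivial {n} G = 2 ≤ n

Labelling : ℕ → Set
Labelling n = Fin n → Fin 3

val : ∀ {n} → Labelling n → Fin n → ℕ
val f v = toℕ (f v)

nbrSum : ∀ {n} → Graph n → Labelling n → Fin n → ℕ
nbrSum {n} G f v = sum (map (λ u → if adj G v u then val f u else 0) (allFin n))

weight : ∀ {n} → Labelling n → ℕ
weight {n} f = sum (map (val f) (allFin n))

IsPID : ∀ {n} → Graph n → Labelling n → Set
IsPID {n} G f = ∀ (v : Fin n) → val f v ≡ 0 → nbrSum G f v ≡ 2

PIDNumberIs : ∀ {n} → Graph n → ℕ → Set
PIDNumberIs {n} G k =
  (∃[ f ] (IsPID G f × weight f ≡ k)) ×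
  (∀ (f : Labelling n) → IsPID G f → k ≤ weight f)

Subset : ℕ → Set
Subset n = Fin n → Bool

InducesK1 : ∀ {n} → Graph n → Subset n → Set
InducesK1 {n} G S = ∃[ a ] (∀ v → (S v ≡ true → v ≡ a) × (v ≡ a → S v ≡ true))

InducesPair : ∀ {n} → Graph n → Subset n → Bool → Set
InducesPair {n} G S e = ∃[ a ] ∃[ b ] (a ≢ b × adj G a b ≡ e ×
  (∀ v → (S v ≡ true → (v ≡ a ⊎ v ≡ b)) × ((v ≡ a ⊎ v ≡ b) → S v ≡ true)))

Induces2K1 : ∀ {n} → Graph n → Subset n → Set
Induces2K1 G S = InducesPair G S false

InducesK2 : ∀ {n} → Graph n → Subset n → Set
InducesK2 G S = InducesPair G S true

IsJoinSplit : ∀ {n} → Graph n → Subset n → Set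
IsJoinSplit {n} G S =
  (∃[ a ] S a ≡ true) × (∃[ b ] S b ≡ false) ×
  (∀ a b → S a ≡ true → S b ≡ false → adj G a b ≡ true)

IsJoinWithSmallFirst : ∀ {n} → Graph n → Set
IsJoinWithSmallFirst {n} G = ∃[ S ] (IsJoinSplit G S ×
  (InducesK1 G S ⊎ Induces2K1 G S ⊎ InducesK2 G S))

-- A vertex labelled 0 by a PID-function sees weight 2 among its neighbours, and
-- a labelling without zeros has weight at least |V| ≥ 2; hence γ_I^p ≥ 2.
-- A PID-function of weight 2 is either a single 2 or two 1's, and a vertex
-- labelled 0 must see the whole weight, so it is adjacent to every vertex of the
-- support: the support is the first side of a join, unless it is all of V, in
-- which case G = K₂ = K₁ ∨ K₁.  Conversely, labelling the first side of such a
-- join by 2 (for K₁) or by 1's (for 2K₁ and K₂) gives a PID-function of weight 2.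
module Submission where

open import Defs hiding (sym)
open import Data.Nat using (ℕ; zero; suc; _+_; _≤_; z≤n; s≤s)
import Data.Nat as ℕ
open import Data.Nat.Properties
  using (≤-refl; ≤-trans; ≤-antisym; +-mono-≤; +-monoʳ-≤; +-cancelʳ-≤; +-cancelˡ-≡;
         +-identityʳ; +-comm; m+n≡0⇒m≡0; m+n≡0⇒n≡0)
open import Data.Nat.ListAction using (sum)
open import Data.Fin using (Fin; zero; suc; toℕ; _≟_)
open import Data.Fin.Properties using (any?; suc-injective)
open import Data.List using (map; allFin; tabulate)
open import Data.List.Properties using (map-tabulate)
open import Data.Bool using (true; false; if_then_else_)
open import Data.Bool.Properties using (¬-not)
open import Data.Product using (∃₂; ∃-syntax; _×_; _,_; proj₁; proj₂)
open import Data.Sum using (_⊎_; inj₁; inj₂; [_,_])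
open import Function using (_∘_; id)
open import Function.Bundles using (_⇔_; mk⇔)
open import Relation.Nullary using (¬_; Dec; yes; no; does; contradiction)
open import Relation.Nullary.Decidable using (dec-true; dec-false; ¬?; _×-dec_; _⊎-dec_)
open import Relation.Unary using (Decidable)
open import Relation.Binary.PropositionalEquality
  using (_≡_; _≢_; refl; sym; trans; cong; cong₂; subst; module ≡-Reasoning)

∑ : ∀ {n} → (Fin n → ℕ) → ℕ
∑ {zero}  g = 0
∑ {suc n} g = g zero + ∑ (g ∘ suc)

sum-map-allFin : ∀ {n} (g : Fin n → ℕ) → sum (map g (allFin n)) ≡ ∑ g
sum-map-allFin g = trans (cong sum (map-tabulate id g)) (sum-tabulate g)
  where
  sum-tabulate : ∀ {m} (h : Fin m → ℕ) → sum (tabulate h) ≡ ∑ h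
  sum-tabulate {zero}  h = refl
  sum-tabulate {suc m} h = cong (h zero +_) (sum-tabulate (h ∘ suc))

∑-cong : ∀ {n} {g h : Fin n → ℕ} → (∀ u → g u ≡ h u) → ∑ g ≡ ∑ h
∑-cong {zero}  g≗h = refl
∑-cong {suc n} g≗h = cong₂ _+_ (g≗h zero) (∑-cong (g≗h ∘ suc))

∑-mono : ∀ {n} {g h : Fin n → ℕ} → (∀ u → g u ≤ h u) → ∑ g ≤ ∑ h
∑-mono {zero}  g≤h = z≤n
∑-mono {suc n} g≤h = +-mono-≤ (g≤h zero) (∑-mono (g≤h ∘ suc))

n≤∑ : ∀ {n} {g : Fin n → ℕ} → (∀ u → 1 ≤ g u) → n ≤ ∑ g
n≤∑ {zero}  1≤g = z≤n
n≤∑ {suc n} 1≤g = +-mono-≤ (1≤g zero) (n≤∑ (1≤g ∘ suc))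

+-mono-≡⇒≡ : ∀ {a b c d} → a ≤ b → c ≤ d → a + c ≡ b + d → a ≡ b × c ≡ d
+-mono-≡⇒≡ {a} {b} {c} {d} a≤b c≤d eq = a≡b , +-cancelˡ-≡ a c d (trans eq (cong (_+ d) (sym a≡b)))
  where
  a≡b : a ≡ b
  a≡b = ≤-antisym a≤b (+-cancelʳ-≤ d b a (subst (_≤ a + d) eq (+-monoʳ-≤ a c≤d)))

∑-mono-≡⇒≗ : ∀ {n} {g h : Fin n → ℕ} → (∀ u → g u ≤ h u) → ∑ g ≡ ∑ h → ∀ u → g u ≡ h u
∑-mono-≡⇒≗ {suc n} g≤h eq u with +-mono-≡⇒≡ (g≤h zero) (∑-mono (g≤h ∘ suc)) eq
∑-mono-≡⇒≗ {suc n} g≤h eq zero    | head≡ , _ = head≡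
∑-mono-≡⇒≗ {suc n} g≤h eq (suc u) | _ , tail≡ = ∑-mono-≡⇒≗ (g≤h ∘ suc) tail≡ u

∑-zero : ∀ {n} {g : Fin n → ℕ} → (∀ u → g u ≡ 0) → ∑ g ≡ 0
∑-zero {zero}  g≡0 = refl
∑-zero {suc n} g≡0 rewrite g≡0 zero = ∑-zero (g≡0 ∘ suc)

∑-single : ∀ {n} {g : Fin n → ℕ} a → (∀ u → u ≢ a → g u ≡ 0) → ∑ g ≡ g a
∑-single {suc n} {g} zero off =
  trans (cong (g zero +_) (∑-zero (λ u → off (suc u) λ ()))) (+-identityʳ _)
∑-single {suc n} (suc a) off rewrite off zero (λ ()) =
  ∑-single a (λ u u≢a → off (suc u) (u≢a ∘ suc-injective))

∑-pair : ∀ {n} {g : Fin n → ℕ} a b → a ≢ b → (∀ u → u ≢ a → u ≢ b → g u ≡ 0) → ∑ g ≡ g a + g b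
∑-pair zero zero a≢b off = contradiction refl a≢b
∑-pair {suc n} {g} zero (suc b) a≢b off =
  cong (g zero +_) (∑-single b (λ u u≢b → off (suc u) (λ ()) (u≢b ∘ suc-injective)))
∑-pair {suc n} {g} (suc a) zero a≢b off =
  trans (cong (g zero +_) (∑-single a (λ u u≢a → off (suc u) (u≢a ∘ suc-injective) (λ ()))))
        (+-comm (g zero) _)
∑-pair (suc a) (suc b) a≢b off rewrite off zero (λ ()) (λ ()) =
  ∑-pair a b (a≢b ∘ cong suc) (λ u u≢a u≢b → off (suc u) (u≢a ∘ suc-injective) (u≢b ∘ suc-injective))

∑≡0⇒≡0 : ∀ {n} {g : Fin n → ℕ} → ∑ g ≡ 0 → ∀ u → g u ≡ 0
∑≡0⇒≡0 {suc n} eq zero    = m+n≡0⇒m≡0 _ eq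
∑≡0⇒≡0 {suc n} eq (suc u) = ∑≡0⇒≡0 (m+n≡0⇒n≡0 _ eq) u

∑≡1⇒single : ∀ {n} {g : Fin n → ℕ} → ∑ g ≡ 1 → ∃[ a ] (g a ≡ 1 × (∀ u → u ≢ a → g u ≡ 0))
∑≡1⇒single {suc n} {g} eq with g zero in g₀
... | zero with ∑≡1⇒single eq
...   | a , ga , off = suc a , ga , λ { zero _ → g₀ ; (suc u) u≢a → off u (u≢a ∘ cong suc) }
∑≡1⇒single {suc n} {g} eq | suc zero =
  zero , g₀ , λ { zero u≢0 → contradiction refl u≢0 ; (suc u) _ → ∑≡0⇒≡0 (cong ℕ.pred eq) u }

∑≡2⇒single⊎pair : ∀ {n} {g : Fin n → ℕ} → ∑ g ≡ 2 →
  (∃[ a ] (g a ≡ 2 × (∀ u → u ≢ a → g u ≡ 0))) ⊎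
  (∃₂ λ a b → a ≢ b × g a ≡ 1 × g b ≡ 1 × (∀ u → u ≢ a → u ≢ b → g u ≡ 0))
∑≡2⇒single⊎pair {suc n} {g} eq with g zero in g₀
... | zero with ∑≡2⇒single⊎pair eq
...   | inj₁ (a , ga , off) =
        inj₁ (suc a , ga , λ { zero _ → g₀ ; (suc u) u≢a → off u (u≢a ∘ cong suc) })
...   | inj₂ (a , b , a≢b , ga , gb , off) =
        inj₂ (suc a , suc b , a≢b ∘ suc-injective , ga , gb ,
              λ { zero _ _ → g₀ ; (suc u) u≢a u≢b → off u (u≢a ∘ cong suc) (u≢b ∘ cong suc) })
∑≡2⇒single⊎pair {suc n} {g} eq | suc zero with ∑≡1⇒single (cong ℕ.pred eq)
... | b , gb , off =
  inj₂ (zero , suc b , (λ ()) , g₀ , gb ,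
        λ { zero u≢0 _ → contradiction refl u≢0 ; (suc u) _ u≢b → off u (u≢b ∘ cong suc) })
∑≡2⇒single⊎pair {suc n} {g} eq | suc (suc zero) =
  inj₁ (zero , g₀ , λ { zero u≢0 → contradiction refl u≢0
                      ; (suc u) _ → ∑≡0⇒≡0 (cong (ℕ.pred ∘ ℕ.pred) eq) u })

contribution : ∀ {n} → Graph n → Labelling n → Fin n → Fin n → ℕ
contribution G f v u = if adj G v u then val f u else 0

contribution≤val : ∀ {n} (G : Graph n) f v u → contribution G f v u ≤ val f u
contribution≤val G f v u with adj G v u
... | true  = ≤-refl
... | false = z≤n

nbrSum≡∑ : ∀ {n} (G : Graph n) f v → nbrSum G f v ≡ ∑ (contribution G f v)
nbrSum≡∑ G f v = sum-map-allFin (contribution G f v)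

weight≡∑ : ∀ {n} (f : Labelling n) → weight f ≡ ∑ (val f)
weight≡∑ f = sum-map-allFin (val f)

pid⇒2≤weight : ∀ {n} (G : Graph n) → NonTrivial G → ∀ f → IsPID G f → 2 ≤ weight f
pid⇒2≤weight G 2≤n f pid rewrite weight≡∑ f with any? (λ v → val f v ℕ.≟ 0)
... | yes (v , fv≡0) =
  subst (_≤ ∑ (val f)) (trans (sym (nbrSum≡∑ G f v)) (pid v fv≡0)) (∑-mono (contribution≤val G f v))
... | no ∄zero = ≤-trans 2≤n (n≤∑ positive)
  where
  positive : ∀ u → 1 ≤ val f u
  positive u with val f u in fu
  ... | zero  = contradiction (u , fu) ∄zero
  ... | suc _ = s≤s z≤n

pid-weight2⇒adjacent : ∀ {n} (G : Graph n) {f} → IsPID G f → weight f ≡ 2 →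
  ∀ {u v k} → val f u ≡ suc k → val f v ≡ 0 → adj G u v ≡ true
pid-weight2⇒adjacent G {f} pid w {u} {v} fu fv = trans (Graph.sym G u v) (seen (sees-all u))
  where
  sees-all : ∀ x → contribution G f v x ≡ val f x
  sees-all = ∑-mono-≡⇒≗ (contribution≤val G f v)
    (trans (sym (nbrSum≡∑ G f v)) (trans (pid v fv) (trans (sym w) (weight≡∑ f))))
  seen : contribution G f v u ≡ val f u → adj G v u ≡ true
  seen eq with adj G v u
  ... | true  = refl
  ... | false = contradiction (trans eq fu) λ ()

indicator : ∀ {n} → Subset n → Fin 3 → Labelling n
indicator S c v = if S v then c else zero

JoinAdjacent : ∀ {n} → Graph n → Subset n → Set
JoinAdjacent G S = ∀ a b → S a ≡ true → S b ≡ false → adj G a b ≡ true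

join-indicator-pid : ∀ {n} (G : Graph n) S c → JoinAdjacent G S →
  weight (indicator S (suc c)) ≡ 2 → IsPID G (indicator S (suc c))
join-indicator-pid {n} G S c join w v fv with S v in Sv
... | false = begin
  nbrSum G f v              ≡⟨ nbrSum≡∑ G f v ⟩
  ∑ (contribution G f v)    ≡⟨ ∑-cong sees ⟩
  ∑ (val f)                 ≡⟨ sym (weight≡∑ f) ⟩
  weight f                  ≡⟨ w ⟩
  2                         ∎
  where
  open ≡-Reasoning
  f : Labelling n
  f = indicator S (suc c)
  sees : ∀ u → contribution G f v u ≡ val f u
  sees u with S u in Su | adj G v u in vu
  ... | true  | true  = refl
  ... | true  | false = contradiction (trans (sym vu) (trans (Graph.sym G v u) (join u v Su Sv))) λ ()
  ... | false | true  = refl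
  ... | false | false = refl

weight-indicator-single : ∀ {n} (S : Subset n) c a →
  (∀ v → (S v ≡ true → v ≡ a) × (v ≡ a → S v ≡ true)) → weight (indicator S c) ≡ toℕ c
weight-indicator-single S c a mem = begin
  weight (indicator S c)     ≡⟨ weight≡∑ (indicator S c) ⟩
  ∑ (val (indicator S c))    ≡⟨ ∑-single a off ⟩
  val (indicator S c) a      ≡⟨ cong (λ b → toℕ (if b then c else zero)) (proj₂ (mem a) refl) ⟩
  toℕ c                      ∎
  where
  open ≡-Reasoning
  off : ∀ u → u ≢ a → val (indicator S c) u ≡ 0
  off u u≢a rewrite ¬-not (u≢a ∘ proj₁ (mem u)) = refl

weight-indicator-pair : ∀ {n} (S : Subset n) c a b → a ≢ b →
  (∀ v → (S v ≡ true → v ≡ a ⊎ v ≡ b) × (v ≡ a ⊎ v ≡ b → S v ≡ true)) →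
  weight (indicator S c) ≡ toℕ c + toℕ c
weight-indicator-pair S c a b a≢b mem = begin
  weight (indicator S c)                           ≡⟨ weight≡∑ (indicator S c) ⟩
  ∑ (val (indicator S c))                          ≡⟨ ∑-pair a b a≢b off ⟩
  val (indicator S c) a + val (indicator S c) b    ≡⟨ cong₂ _+_ (inside (inj₁ refl)) (inside (inj₂ refl)) ⟩
  toℕ c + toℕ c                                    ∎
  where
  open ≡-Reasoning
  inside : ∀ {v} → v ≡ a ⊎ v ≡ b → val (indicator S c) v ≡ toℕ c
  inside {v} v∈ = cong (λ x → toℕ (if x then c else zero)) (proj₂ (mem v) v∈)
  off : ∀ u → u ≢ a → u ≢ b → val (indicator S c) u ≡ 0
  off u u≢a u≢b rewrite ¬-not ([ u≢a , u≢b ] ∘ proj₁ (mem u)) = refl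

does-sound : ∀ {ℓ} {A : Set ℓ} (a? : Dec A) → does a? ≡ true → A
does-sound (yes a) _ = a

join-split : ∀ {n} (G : Graph n) {P : Fin n → Set} (P? : Decidable P) {a c} → P a → ¬ P c →
  (∀ x y → P x → ¬ P y → adj G x y ≡ true) → IsJoinSplit G (λ v → does (P? v))
join-split G P? {a} {c} Pa ¬Pc join =
  (a , dec-true (P? a) Pa) , (c , dec-false (P? c) ¬Pc) ,
  λ x y Sx Sy → join x y (does-sound (P? x) Sx) (λ Py → contradiction (trans (sym (dec-true (P? y) Py)) Sy) λ ())

∃≢ : ∀ {n} → 2 ≤ n → (a : Fin n) → ∃[ c ] c ≢ a
∃≢ (s≤s (s≤s _)) zero    = suc zero , λ ()
∃≢ (s≤s (s≤s _)) (suc a) = zero , λ ()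

star⇒join : ∀ {n} (G : Graph n) → NonTrivial G → ∀ a →
  (∀ y → y ≢ a → adj G a y ≡ true) → IsJoinWithSmallFirst G
star⇒join G 2≤n a star with ∃≢ 2≤n a
... | c , c≢a =
  (λ v → does (v ≟ a)) ,
  join-split G (_≟ a) refl c≢a (λ { x y refl y≢a → star y y≢a }) ,
  inj₁ (a , λ v → does-sound (v ≟ a) , dec-true (v ≟ a))

pair⇒join : ∀ {n} (G : Graph n) {a b c} → a ≢ b → c ≢ a → c ≢ b →
  (∀ y → y ≢ a → y ≢ b → adj G a y ≡ true × adj G b y ≡ true) → IsJoinWithSmallFirst G
pair⇒join {n} G {a} {b} a≢b c≢a c≢b both =
  S , join-split G P? (inj₁ refl) [ c≢a , c≢b ] adjacent , shape
  where
  P? : Decidable (λ v → v ≡ a ⊎ v ≡ b)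
  P? v = v ≟ a ⊎-dec v ≟ b
  S : Subset n
  S v = does (P? v)
  adjacent : ∀ x y → x ≡ a ⊎ x ≡ b → ¬ (y ≡ a ⊎ y ≡ b) → adj G x y ≡ true
  adjacent x y (inj₁ refl) y∉ = proj₁ (both y (y∉ ∘ inj₁) (y∉ ∘ inj₂))
  adjacent x y (inj₂ refl) y∉ = proj₂ (both y (y∉ ∘ inj₁) (y∉ ∘ inj₂))
  mem : ∀ v → (S v ≡ true → v ≡ a ⊎ v ≡ b) × (v ≡ a ⊎ v ≡ b → S v ≡ true)
  mem v = does-sound (P? v) , dec-true (P? v)
  shape : InducesK1 G S ⊎ Induces2K1 G S ⊎ InducesK2 G S
  shape with adj G a b in ab
  ... | false = inj₂ (inj₁ (a , b , a≢b , ab , mem))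
  ... | true  = inj₂ (inj₂ (a , b , a≢b , ab , mem))

connected-two-vertices⇒adjacent : ∀ {n} (G : Graph n) → Connected G → ∀ {a b} → a ≢ b →
  (∀ c → c ≡ a ⊎ c ≡ b) → adj G a b ≡ true
connected-two-vertices⇒adjacent G conn {a} {b} a≢b covers with conn a b
... | here = contradiction refl a≢b
... | step {w = w} aw _ with covers w
...   | inj₁ refl = contradiction (trans (sym aw) (Graph.irrefl G a)) λ ()
...   | inj₂ refl = aw

pid-weight2⇒join : ∀ {n} (G : Graph n) → NonTrivial G → Connected G →
  ∀ {f} → IsPID G f → weight f ≡ 2 → IsJoinWithSmallFirst G
pid-weight2⇒join G 2≤n conn {f} pid w with ∑≡2⇒single⊎pair (trans (sym (weight≡∑ f)) w)
... | inj₁ (a , fa , off) =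
  star⇒join G 2≤n a (λ y y≢a → pid-weight2⇒adjacent G pid w fa (off y y≢a))
... | inj₂ (a , b , a≢b , fa , fb , off) with any? (λ c → ¬? (c ≟ a) ×-dec ¬? (c ≟ b))
...   | yes (c , c≢a , c≢b) = pair⇒join G a≢b c≢a c≢b λ y y≢a y≢b →
  pid-weight2⇒adjacent G pid w fa (off y y≢a y≢b) , pid-weight2⇒adjacent G pid w fb (off y y≢a y≢b)
...   | no ∄c = star⇒join G 2≤n a star
  where
  covers : ∀ c → c ≡ a ⊎ c ≡ b
  covers c with c ≟ a | c ≟ b
  ... | yes c≡a | _       = inj₁ c≡a
  ... | no _    | yes c≡b = inj₂ c≡b
  ... | no c≢a  | no c≢b  = contradiction (c , c≢a , c≢b) ∄c
  star : ∀ y → y ≢ a → adj G a y ≡ true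
  star y y≢a with covers y
  ... | inj₁ y≡a = contradiction y≡a y≢a
  ... | inj₂ refl = connected-two-vertices⇒adjacent G conn a≢b covers

join-K1⇒pid-weight2 : ∀ {n} (G : Graph n) S → JoinAdjacent G S → InducesK1 G S →
  ∃[ f ] (IsPID G f × weight f ≡ 2)
join-K1⇒pid-weight2 G S join (a , mem) =
  indicator S (suc (suc zero)) , join-indicator-pid G S (suc zero) join w , w
  where
  w : weight (indicator S (suc (suc zero))) ≡ 2
  w = weight-indicator-single S (suc (suc zero)) a mem

join-pair⇒pid-weight2 : ∀ {n} (G : Graph n) S {e} → JoinAdjacent G S → InducesPair G S e →
  ∃[ f ] (IsPID G f × weight f ≡ 2)
join-pair⇒pid-weight2 G S join (a , b , a≢b , _ , mem) =
  indicator S (suc zero) , join-indicator-pid G S zero join w , w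
  where
  w : weight (indicator S (suc zero)) ≡ 2
  w = weight-indicator-pair S (suc zero) a b a≢b mem

join⇒pid-weight2 : ∀ {n} (G : Graph n) → IsJoinWithSmallFirst G → ∃[ f ] (IsPID G f × weight f ≡ 2)
join⇒pid-weight2 G (S , (_ , _ , join) , inj₁ k₁)         = join-K1⇒pid-weight2 G S join k₁
join⇒pid-weight2 G (S , (_ , _ , join) , inj₂ (inj₁ 2k₁)) = join-pair⇒pid-weight2 G S join 2k₁
join⇒pid-weight2 G (S , (_ , _ , join) , inj₂ (inj₂ k₂))  = join-pair⇒pid-weight2 G S join k₂

proposition5 : ∀ (n : ℕ) (G : Graph n) → NonTrivial G → Connected G →
    (PIDNumberIs G 2 ⇔ IsJoinWithSmallFirst G)
proposition5 n G 2≤n conn = mk⇔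
  (λ { ((f , pid , w) , _) → pid-weight2⇒join G 2≤n conn pid w })
  (λ split → join⇒pid-weight2 G split , pid⇒2≤weight G 2≤n)
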